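{- Let $(G,\mathbf{w})$ be a connected weighted graph with vertices $v_1,\dots,v_n$, and let $w_{ij}=d_\mathbf{w}(v_i,v_j)$. Then $c(G,\mathbf{w})$ equals the optimal value of the integer program $$\min \sum_{A\subseteq [n]} S_A \quad\text{s.t.}\quad \sum_{A\subseteq[n]:\ |A\cap\{i,j\}|=1} S_A \ge w_{ij}\ \ \forall\, 1\le i<j\le n,\qquad S_A\in\mathbb{Z}_{\ge 0}\ \ \forall A\subseteq[n].$$
   Context: A weighted graph $(G,\mathbf{w})$ is a finite simple graph with positive integer edge weights that is weight-minimal: every edge is a shortest path between its endpoints. $d_\mathbf{w}(u,v)$ is the minimum total weight of a $(u,v)$-path. A binary addressing of length $m$ is a map $f:V(G)\to\{0,1\}^m$ with $d_\mathbf{w}(u,v)\le d_H(f(u),f(v))$ for all $u,v$ ($d_H$ the Hamming distance); $c(G,\mathbf{w})$ is the minimum such $m$. $[n]=\{1,\dots,n\}$. -}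

module Defs where

open import Data.Nat using (ℕ; zero; suc; _+_; _≤_; _<_)
open import Data.Bool using (Bool; true; false; if_then_else_; _xor_)
open import Data.Fin using (Fin)
open import Data.Vec using (Vec; []; _∷_; lookup)
open import Data.List using (List; []; _∷_; map; _++_)
open import Data.Nat.ListAction using (sum)
open import Data.List.Relation.Unary.Unique.Propositional using (Unique)
open import Data.Fin.Subset using (Subset; inside; outside)
open import Data.Product using (Σ; _×_; _,_)
open import Relation.Binary.PropositionalEquality using (_≡_)

-- A finite simple graph on vertex set Fin n with positive integer edge weights,
-- encoded by a weight matrix: w i j = 0 means "no edge", w i j ≥ 1 is the weight
-- of the edge {i,j}.
record WeightedGraph (n : ℕ) : Set where
  field
    w     : Fin n → Fin n → ℕ
    sym   : ∀ i j → w i j ≡ w j i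
    loopless : ∀ i → w i i ≡ 0

module _ {n : ℕ} (G : WeightedGraph n) where
  open WeightedGraph G

  Edge : Fin n → Fin n → Set
  Edge i j = 0 < w i j

  data Walk : Fin n → Fin n → Set where
    nil  : ∀ {u} → Walk u u
    cons : ∀ {u v t} → Edge u v → Walk v t → Walk u t

  vertices : ∀ {u v} → Walk u v → List (Fin n)
  vertices {u} nil = u ∷ []
  vertices {u} (cons _ p) = u ∷ vertices p

  weight : ∀ {u v} → Walk u v → ℕ
  weight nil = 0
  weight {u} (cons {v = v} _ p) = w u v + weight p

  IsPath : ∀ {u v} → Walk u v → Set
  IsPath p = Unique (vertices p)

  IsDist : Fin n → Fin n → ℕ → Set
  IsDist u v d =
    Σ (Walk u v) (λ p → IsPath p × weight p ≡ d)
    × (∀ (q : Walk u v) → IsPath q → d ≤ weight q)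

  Connected : Set
  Connected = ∀ u v → Σ (Walk u v) IsPath

  WeightMinimal : Set
  WeightMinimal = ∀ u v → Edge u v → ∀ (q : Walk u v) → IsPath q → w u v ≤ weight q

hamming : ∀ {m} → Vec Bool m → Vec Bool m → ℕ
hamming [] [] = 0
hamming (x ∷ xs) (y ∷ ys) = (if x xor y then 1 else 0) + hamming xs ys

IsAddressing : ∀ {n} (G : WeightedGraph n) (m : ℕ) → (Fin n → Vec Bool m) → Set
IsAddressing {n} G m f =
  ∀ (u v : Fin n) (d : ℕ) → IsDist G u v d → d ≤ hamming (f u) (f v)

IsMin : (ℕ → Set) → ℕ → Set
IsMin P m = P m × (∀ k → P k → m ≤ k)

IsAddressingNumber : ∀ {n} → WeightedGraph n → ℕ → Set
IsAddressingNumber {n} G = IsMin (λ m → Σ (Fin n → Vec Bool m) (IsAddressing G m))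

allSubsets : (n : ℕ) → List (Subset n)
allSubsets zero = [] ∷ []
allSubsets (suc n) = map (inside ∷_) (allSubsets n) ++ map (outside ∷_) (allSubsets n)

Separates : ∀ {n} → Subset n → Fin n → Fin n → Bool
Separates A i j = lookup A i xor lookup A j

totalSum : ∀ {n} → (Subset n → ℕ) → ℕ
totalSum {n} S = sum (map S (allSubsets n))

cutSum : ∀ {n} → (Subset n → ℕ) → Fin n → Fin n → ℕ
cutSum {n} S i j = sum (map (λ A → if Separates A i j then S A else 0) (allSubsets n))

IPFeasible : ∀ {n} → WeightedGraph n → (Subset n → ℕ) → Set
IPFeasible {n} G S =
  ∀ (i j : Fin n) → i Data.Fin.< j → ∀ d → IsDist G i j d → d ≤ cutSum S i j

IsIPOptimum : ∀ {n} → WeightedGraph n → ℕ → Set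
IsIPOptimum G = IsMin (λ m → Σ (_ → ℕ) (λ S → IPFeasible G S × totalSum S ≡ m))

{-# OPTIONS --safe #-}
-- An addressing f of length m is an n × m Boolean matrix, i.e. a list of m cuts (its
-- columns), and d_H(f u, f v) is the number of those cuts separating u and v. Counting
-- how often each subset occurs turns m cuts into a feasible solution of total m, and
-- repeating every subset A exactly S_A times turns a feasible solution back into cuts, so
-- both problems have the same feasible values. The common minimum exists because in a
-- connected graph the distances exist (bounded path search is decidable), so addressings
-- of a given length can be searched exhaustively, and the solution giving every subset
-- weight diam(G) is feasible.
module Submission where

open import Defs
open import Data.Bool using (Bool; true; false; if_then_else_; _xor_)
open import Data.Bool.Properties using (xor-comm; ¬-not) renaming (_≟_ to _≟ᵇ_)
open import Data.Empty using (⊥-elim)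
open import Data.Fin as Fin using (Fin)
open import Data.Fin.Properties using (any?; all?) renaming (<-cmp to <-cmpᶠ; <⇒≢ to <⇒≢ᶠ)
open import Data.Fin.Subset using (Subset; ⁅_⁆)
open import Data.Fin.Subset.Properties using (anySubset?; x∈⁅x⁆; x≢y⇒x∉⁅y⁆)
open import Data.List as List using (List; []; _∷_; map; _++_; length; replicate)
open import Data.List.Properties using (map-cong; map-++; map-∘; unfold-reverse; length-++; length-replicate)
open import Data.List.Membership.Propositional using (_∈_; _∉_)
open import Data.List.Membership.Propositional.Properties using (∈-++⁺ˡ; ∈-++⁺ʳ; ∈-map⁺)
import Data.List.Membership.DecPropositional as DecMembership
open import Data.List.Relation.Unary.All as All using (All; []; _∷_)
open import Data.List.Relation.Unary.Any using (here; there)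
open import Data.List.Relation.Unary.AllPairs using ([]; _∷_)
open import Data.List.Relation.Unary.Unique.Propositional using (Unique)
open import Data.List.Relation.Binary.Permutation.Propositional using (↭-sym; ↭⇒↭ₛ)
open import Data.List.Relation.Binary.Permutation.Propositional.Properties using (↭-reverse)
import Data.List.Relation.Binary.Permutation.Setoid.Properties as PermutationProperties
open import Data.Nat using (ℕ; zero; suc; _+_; _*_; _∸_; _≤_; _<_; _⊔_; z≤n)
open import Data.Nat.Properties
open import Algebra.Properties.CommutativeSemigroup +-commutativeSemigroup using (interchange)
open import Data.Nat.Induction using (<-rec)
open import Data.Nat.ListAction using (sum)
open import Data.Nat.ListAction.Properties using (sum-++)
open import Data.Product using (Σ; ∃; _×_; _,_; proj₁; proj₂)
open import Data.Vec as Vec using (Vec; []; _∷_; lookup; tabulate)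
open import Data.Vec.Properties using (lookup∘tabulate; ≡-dec; []=⇒lookup; lookup⇒[]=)
open import Function using (_∘_; _⇔_; mk⇔; Equivalence)
open import Level using (0ℓ)
open import Relation.Binary.Definitions using (tri<; tri≈; tri>)
open import Relation.Binary.PropositionalEquality
open import Relation.Nullary using (Dec; yes; no; does)
import Relation.Nullary.Decidable as Dec
open import Relation.Unary using (Pred; Decidable)

least : {P : ℕ → Set} → Decidable P → ∀ {N} → P N → ∃ (IsMin P)
least {P} P? {N} = <-rec (λ N → P N → ∃ (IsMin P)) minimise N
  where
  minimise : ∀ N → (∀ {k} → k < N → P k → ∃ (IsMin P)) → P N → ∃ (IsMin P)
  minimise N below pN with anyUpTo? P? N
  ... | yes (k , k<N , pk) = below k<N pk
  ... | no none = N , pN , λ k pk → ≮⇒≥ (λ k<N → none (k , k<N , pk))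

IsMin-resp-⇔ : {P Q : ℕ → Set} → (∀ k → P k ⇔ Q k) → ∀ {m} → IsMin P m → IsMin Q m
IsMin-resp-⇔ P⇔Q (pm , minimal) =
  Equivalence.to (P⇔Q _) pm , λ k qk → minimal k (Equivalence.from (P⇔Q k) qk)

any-Vec? : {A : Set} → (∀ {P : Pred A 0ℓ} → Decidable P → Dec (∃ P)) →
           ∀ {k} {P : Pred (Vec A k) 0ℓ} → Decidable P → Dec (∃ P)
any-Vec? any-A? {zero} P? = Dec.map (mk⇔ ([] ,_) λ { ([] , p) → p }) (P? [])
any-Vec? any-A? {suc k} P? =
  Dec.map (mk⇔ (λ (x , xs , p) → x ∷ xs , p) λ { (x ∷ xs , p) → x , xs , p })
          (any-A? λ x → any-Vec? any-A? (P? ∘ (x ∷_)))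

maxFin : ∀ {n} → (Fin n → ℕ) → ℕ
maxFin {zero} f = 0
maxFin {suc n} f = f Fin.zero ⊔ maxFin (f ∘ Fin.suc)

≤-maxFin : ∀ {n} (f : Fin n → ℕ) i → f i ≤ maxFin f
≤-maxFin f Fin.zero = m≤m⊔n _ _
≤-maxFin f (Fin.suc i) = ≤-trans (≤-maxFin (f ∘ Fin.suc) i) (m≤n⊔m _ _)

module _ {A : Set} where

  sum-map-+ : ∀ (f g : A → ℕ) xs →
    sum (map (λ x → f x + g x) xs) ≡ sum (map f xs) + sum (map g xs)
  sum-map-+ f g [] = refl
  sum-map-+ f g (x ∷ xs) =
    trans (cong (f x + g x +_) (sum-map-+ f g xs)) (interchange (f x) (g x) _ _)

  sum-map-++ : ∀ (f : A → ℕ) xs ys → sum (map f (xs ++ ys)) ≡ sum (map f xs) + sum (map f ys)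
  sum-map-++ f xs ys = trans (cong sum (map-++ f xs ys)) (sum-++ (map f xs) (map f ys))

  sum-map-zero : ∀ (xs : List A) → sum (map (λ _ → 0) xs) ≡ 0
  sum-map-zero [] = refl
  sum-map-zero (x ∷ xs) = sum-map-zero xs

  sum-map-one : ∀ (xs : List A) → sum (map (λ _ → 1) xs) ≡ length xs
  sum-map-one [] = refl
  sum-map-one (x ∷ xs) = cong suc (sum-map-one xs)

  ∈⇒≤sum-map : ∀ (f : A → ℕ) {x xs} → x ∈ xs → f x ≤ sum (map f xs)
  ∈⇒≤sum-map f (here refl) = m≤m+n _ _
  ∈⇒≤sum-map f (there x∈xs) = ≤-trans (∈⇒≤sum-map f x∈xs) (m≤n+m _ _)

  replicateEach : (A → ℕ) → List A → List A
  replicateEach S [] = []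
  replicateEach S (x ∷ xs) = replicate (S x) x ++ replicateEach S xs

  length-replicateEach : ∀ S xs → length (replicateEach S xs) ≡ sum (map S xs)
  length-replicateEach S [] = refl
  length-replicateEach S (x ∷ xs) =
    trans (length-++ (replicate (S x) x)) (cong₂ _+_ (length-replicate (S x)) (length-replicateEach S xs))

  sum-map-replicate : ∀ (g : A → ℕ) k x → sum (map g (replicate k x)) ≡ k * g x
  sum-map-replicate g zero x = refl
  sum-map-replicate g (suc k) x = cong (g x +_) (sum-map-replicate g k x)

  sum-map-replicateEach : ∀ S (g : A → ℕ) xs →
    sum (map g (replicateEach S xs)) ≡ sum (map (λ x → S x * g x) xs)
  sum-map-replicateEach S g [] = refl
  sum-map-replicateEach S g (x ∷ xs) =
    trans (sum-map-++ g (replicate (S x) x) (replicateEach S xs))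
          (cong₂ _+_ (sum-map-replicate g (S x) x) (sum-map-replicateEach S g xs))

hamming-head-tail : ∀ {m} (xs ys : Vec Bool (suc m)) →
  hamming xs ys ≡ (if Vec.head xs xor Vec.head ys then 1 else 0) + hamming (Vec.tail xs) (Vec.tail ys)
hamming-head-tail (x ∷ xs) (y ∷ ys) = refl

*-indicator : ∀ b x → x * (if b then 1 else 0) ≡ (if b then x else 0)
*-indicator true x = *-identityʳ x
*-indicator false x = *-zeroʳ x

module _ {n : ℕ} (G : WeightedGraph n) where
  open WeightedGraph G renaming (sym to w-sym)
  open DecMembership (Fin._≟_ {n}) using (_∈?_)

  Edge-sym : ∀ {u v} → Edge G u v → Edge G v u
  Edge-sym {u} {v} = subst (0 <_) (w-sym u v)

  snoc : ∀ {u v t} → Walk G u v → Edge G v t → Walk G u t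
  snoc nil e = cons e nil
  snoc (cons e′ p) e = cons e′ (snoc p e)

  vertices-snoc : ∀ {u v t} (p : Walk G u v) (e : Edge G v t) →
    vertices G (snoc p e) ≡ vertices G p ++ t ∷ []
  vertices-snoc nil e = refl
  vertices-snoc (cons _ p) e = cong (_ ∷_) (vertices-snoc p e)

  weight-snoc : ∀ {u v t} (p : Walk G u v) (e : Edge G v t) →
    weight G (snoc p e) ≡ weight G p + w v t
  weight-snoc nil e = +-identityʳ _
  weight-snoc {u} (cons {v = x} _ p) e =
    trans (cong (w u x +_) (weight-snoc p e)) (sym (+-assoc (w u x) _ _))

  reverseWalk : ∀ {u v} → Walk G u v → Walk G v u
  reverseWalk nil = nil
  reverseWalk (cons e p) = snoc (reverseWalk p) (Edge-sym e)

  vertices-reverseWalk : ∀ {u v} (p : Walk G u v) →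
    vertices G (reverseWalk p) ≡ List.reverse (vertices G p)
  vertices-reverseWalk nil = refl
  vertices-reverseWalk {u} (cons e p) = begin
    vertices G (snoc (reverseWalk p) (Edge-sym e))  ≡⟨ vertices-snoc (reverseWalk p) (Edge-sym e) ⟩
    vertices G (reverseWalk p) ++ u ∷ []            ≡⟨ cong (_++ u ∷ []) (vertices-reverseWalk p) ⟩
    List.reverse (vertices G p) ++ u ∷ []           ≡⟨ unfold-reverse u (vertices G p) ⟨
    List.reverse (u ∷ vertices G p)                 ∎
    where open ≡-Reasoning

  weight-reverseWalk : ∀ {u v} (p : Walk G u v) → weight G (reverseWalk p) ≡ weight G p
  weight-reverseWalk nil = refl
  weight-reverseWalk {u} (cons {v = x} e p) = begin
    weight G (snoc (reverseWalk p) (Edge-sym e))  ≡⟨ weight-snoc (reverseWalk p) (Edge-sym e) ⟩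
    weight G (reverseWalk p) + w x u              ≡⟨ cong₂ _+_ (weight-reverseWalk p) (w-sym x u) ⟩
    weight G p + w u x                            ≡⟨ +-comm (weight G p) (w u x) ⟩
    w u x + weight G p                            ∎
    where open ≡-Reasoning

  reverseWalk-isPath : ∀ {u v} (p : Walk G u v) → IsPath G p → IsPath G (reverseWalk p)
  reverseWalk-isPath p path = subst Unique (sym (vertices-reverseWalk p))
    (PermutationProperties.Unique-resp-↭ (setoid (Fin n)) (↭⇒↭ₛ (↭-sym (↭-reverse _))) path)

  IsDist-sym : ∀ {u v d} → IsDist G u v d → IsDist G v u d
  IsDist-sym ((p , path , wp) , shortest) =
    (reverseWalk p , reverseWalk-isPath p path , trans (weight-reverseWalk p) wp) ,
    λ q qpath → subst (_ ≤_) (weight-reverseWalk q)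
                      (shortest (reverseWalk q) (reverseWalk-isPath q qpath))

  IsDist-functional : ∀ {u v d d′} → IsDist G u v d → IsDist G u v d′ → d ≡ d′
  IsDist-functional ((p , path , wp) , shortest) ((p′ , path′ , wp′) , shortest′) =
    ≤-antisym (subst (_ ≤_) wp′ (shortest p′ path′)) (subst (_ ≤_) wp (shortest′ p path))

  IsDist-diag : ∀ {u d} → IsDist G u u d → d ≡ 0
  IsDist-diag (_ , shortest) = n≤0⇒n≡0 (shortest nil ([] ∷ []))

  ∈-vertices : ∀ {u v} (p : Walk G u v) → u ∈ vertices G p
  ∈-vertices nil = here refl
  ∈-vertices (cons _ _) = here refl

  -- The distance from u to v is the least h admitting such a path with X = [].
  PathAvoiding : List (Fin n) → Fin n → Fin n → ℕ → Set
  PathAvoiding X u v h =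
    Σ (Walk G u v) λ p → IsPath G p × All (_∉ X) (vertices G p) × weight G p ≤ h

  FirstStep : List (Fin n) → Fin n → Fin n → ℕ → Fin n → Set
  FirstStep X u v h x = Edge G u x × w u x ≤ h × PathAvoiding (u ∷ X) x v (h ∸ w u x)

  FirstStep⇔PathAvoiding : ∀ {X u v h} → u ∉ X → u ≢ v → ∃ (FirstStep X u v h) ⇔ PathAvoiding X u v h
  FirstStep⇔PathAvoiding {X} {u} {v} {h} u∉X u≢v = mk⇔ extend split
    where
    extend : ∃ (FirstStep X u v h) → PathAvoiding X u v h
    extend (x , e , wux≤h , p , path , avoids , wp) =
      cons e p ,
      All.map (λ y∉u∷X u≡y → y∉u∷X (here (sym u≡y))) avoids ∷ path ,
      u∉X ∷ All.map (_∘ there) avoids ,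
      subst (_ ≤_) (m+[n∸m]≡n wux≤h) (+-monoʳ-≤ (w u x) wp)
    split : PathAvoiding X u v h → ∃ (FirstStep X u v h)
    split (nil , _) = ⊥-elim (u≢v refl)
    split (cons {v = x} e p , fresh ∷ path , _ ∷ avoids , wp) =
      x , e , m+n≤o⇒m≤o (w u x) wp ,
      p , path , All.zipWith avoid-∷ (fresh , avoids) ,
      m+n≤o⇒m≤o∸n (weight G p) (subst (_≤ h) (+-comm (w u x) _) wp)
      where
      avoid-∷ : ∀ {y} → u ≢ y × y ∉ X → y ∉ u ∷ X
      avoid-∷ (u≢y , _) (here y≡u) = u≢y (sym y≡u)
      avoid-∷ (_ , y∉X) (there y∈X) = y∉X y∈X

  pathAvoiding? : ∀ h X u v → Dec (PathAvoiding X u v h)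
  pathAvoiding? = <-rec _ search
    where
    search : ∀ h → (∀ {k} → k < h → ∀ X u v → Dec (PathAvoiding X u v k)) →
             ∀ X u v → Dec (PathAvoiding X u v h)
    search h shorter X u v with u ∈? X | u Fin.≟ v
    ... | yes u∈X | _ = no λ (p , _ , avoids , _) → All.lookup avoids (∈-vertices p) u∈X
    ... | no u∉X | yes refl = yes (nil , [] ∷ [] , u∉X ∷ [] , z≤n)
    ... | no u∉X | no u≢v = Dec.map (FirstStep⇔PathAvoiding u∉X u≢v) (any? firstStep?)
      where
      firstStep? : ∀ x → Dec (FirstStep X u v h x)
      firstStep? x with 0 <? w u x | w u x ≤? h
      ... | no ¬e | _ = no (¬e ∘ proj₁)
      ... | yes _ | no ¬le = no (¬le ∘ proj₁ ∘ proj₂)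
      ... | yes e | yes le = Dec.map′ (λ p → e , le , p) (proj₂ ∘ proj₂)
                               (shorter (∸-monoʳ-< e le) (u ∷ X) x v)

  avoids-[] : ∀ {u v} (p : Walk G u v) → All (_∉ []) (vertices G p)
  avoids-[] p = All.universal (λ _ ()) _

  distance : Connected G → ∀ u v → ∃ (IsDist G u v)
  distance connected u v with connected u v
  ... | p₀ , path₀ with least (λ h → pathAvoiding? h [] u v) (p₀ , path₀ , avoids-[] p₀ , ≤-refl)
  ... | h , (p , path , _ , wp) , minimal =
    h , (p , path , ≤-antisym wp (minimal _ (p , path , avoids-[] p , ≤-refl))) ,
    λ q qpath → minimal _ (q , qpath , avoids-[] q , ≤-refl)

δ : ∀ {n} → Subset n → Subset n → ℕ
δ A B = if does (≡-dec _≟ᵇ_ A B) then 1 else 0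

totalSum-suc : ∀ {n} (g : Subset (suc n) → ℕ) →
  totalSum g ≡ totalSum (g ∘ (true ∷_)) + totalSum (g ∘ (false ∷_))
totalSum-suc {n} g = trans (sum-map-++ g (map (true ∷_) (allSubsets n)) _)
  (cong₂ _+_ (cong sum (sym (map-∘ (allSubsets n)))) (cong sum (sym (map-∘ (allSubsets n)))))

totalSum-δ : ∀ {n} (c : Subset n) (g : Subset n → ℕ) → totalSum (λ A → δ c A * g A) ≡ g c
totalSum-δ [] g = trans (+-identityʳ _) (+-identityʳ _)
totalSum-δ {suc n} (true ∷ c) g = trans (totalSum-suc (λ A → δ (true ∷ c) A * g A))
  (trans (cong₂ _+_ (totalSum-δ c (g ∘ (true ∷_))) (sum-map-zero (allSubsets n))) (+-identityʳ _))
totalSum-δ {suc n} (false ∷ c) g = trans (totalSum-suc (λ A → δ (false ∷ c) A * g A))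
  (cong₂ _+_ (sum-map-zero (allSubsets n)) (totalSum-δ c (g ∘ (false ∷_))))

∈-allSubsets : ∀ {n} (A : Subset n) → A ∈ allSubsets n
∈-allSubsets [] = here refl
∈-allSubsets (true ∷ A) = ∈-++⁺ˡ (∈-map⁺ (true ∷_) (∈-allSubsets A))
∈-allSubsets {suc n} (false ∷ A) =
  ∈-++⁺ʳ (map (true ∷_) (allSubsets n)) (∈-map⁺ (false ∷_) (∈-allSubsets A))

cutSum-sym : ∀ {n} (S : Subset n → ℕ) i j → cutSum S i j ≡ cutSum S j i
cutSum-sym {n} S i j = cong sum (map-cong (λ A →
  cong (λ b → if b then S A else 0) (xor-comm (lookup A i) (lookup A j))) (allSubsets n))

Separates-⁅⁆ : ∀ {n} {i j : Fin n} → i ≢ j → Separates ⁅ i ⁆ i j ≡ true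
Separates-⁅⁆ {i = i} {j} i≢j = cong₂ _xor_ ([]=⇒lookup (x∈⁅x⁆ i))
  (¬-not (x≢y⇒x∉⁅y⁆ (i≢j ∘ sym) ∘ lookup⇒[]= j ⁅ i ⁆))

module _ {n : ℕ} where

  crossings : List (Subset n) → Fin n → Fin n → ℕ
  crossings cs i j = sum (map (λ A → if Separates A i j then 1 else 0) cs)

  multiplicity : List (Subset n) → Subset n → ℕ
  multiplicity cs A = sum (map (λ c → δ c A) cs)

  totalSum-multiplicity-* : ∀ cs (g : Subset n → ℕ) →
    totalSum (λ A → multiplicity cs A * g A) ≡ sum (map g cs)
  totalSum-multiplicity-* [] g = sum-map-zero (allSubsets n)
  totalSum-multiplicity-* (c ∷ cs) g = begin
    totalSum (λ A → (δ c A + multiplicity cs A) * g A)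
      ≡⟨ cong sum (map-cong (λ A → *-distribʳ-+ (g A) (δ c A) _) (allSubsets n)) ⟩
    totalSum (λ A → δ c A * g A + multiplicity cs A * g A)
      ≡⟨ sum-map-+ _ _ (allSubsets n) ⟩
    totalSum (λ A → δ c A * g A) + totalSum (λ A → multiplicity cs A * g A)
      ≡⟨ cong₂ _+_ (totalSum-δ c g) (totalSum-multiplicity-* cs g) ⟩
    g c + sum (map g cs)
      ∎
    where open ≡-Reasoning

  totalSum-multiplicity : ∀ cs → totalSum (multiplicity cs) ≡ length cs
  totalSum-multiplicity cs = begin
    totalSum (multiplicity cs)
      ≡⟨ cong sum (map-cong (λ A → sym (*-identityʳ (multiplicity cs A))) (allSubsets n)) ⟩
    totalSum (λ A → multiplicity cs A * 1)  ≡⟨ totalSum-multiplicity-* cs (λ _ → 1) ⟩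
    sum (map (λ _ → 1) cs)                  ≡⟨ sum-map-one cs ⟩
    length cs                               ∎
    where open ≡-Reasoning

  cutSum-multiplicity : ∀ cs i j → cutSum (multiplicity cs) i j ≡ crossings cs i j
  cutSum-multiplicity cs i j =
    trans (cong sum (map-cong (λ A → sym (*-indicator (Separates A i j) (multiplicity cs A)))
                              (allSubsets n)))
          (totalSum-multiplicity-* cs _)

  cuts : (Subset n → ℕ) → List (Subset n)
  cuts S = replicateEach S (allSubsets n)

  length-cuts : ∀ S → length (cuts S) ≡ totalSum S
  length-cuts S = length-replicateEach S (allSubsets n)

  crossings-cuts : ∀ S i j → crossings (cuts S) i j ≡ cutSum S i j
  crossings-cuts S i j =
    trans (sum-map-replicateEach S _ (allSubsets n))
          (cong sum (map-cong (λ A → *-indicator (Separates A i j) (S A)) (allSubsets n)))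

  columns : ∀ {m} → (Fin n → Vec Bool m) → List (Subset n)
  columns {zero} f = []
  columns {suc m} f = tabulate (Vec.head ∘ f) ∷ columns (Vec.tail ∘ f)

  length-columns : ∀ {m} (f : Fin n → Vec Bool m) → length (columns f) ≡ m
  length-columns {zero} f = refl
  length-columns {suc m} f = cong suc (length-columns (Vec.tail ∘ f))

  hamming-columns : ∀ {m} (f : Fin n → Vec Bool m) i j → hamming (f i) (f j) ≡ crossings (columns f) i j
  hamming-columns {zero} f i j with f i | f j
  ... | [] | [] = refl
  hamming-columns {suc m} f i j = trans (hamming-head-tail (f i) (f j))
    (cong₂ _+_ (sym (cong₂ (λ a b → if a xor b then 1 else 0)
                           (lookup∘tabulate (Vec.head ∘ f) i) (lookup∘tabulate (Vec.head ∘ f) j)))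
               (hamming-columns (Vec.tail ∘ f) i j))

  rows : (cs : List (Subset n)) → Fin n → Vec Bool (length cs)
  rows [] u = []
  rows (c ∷ cs) u = lookup c u ∷ rows cs u

  hamming-rows : ∀ cs i j → hamming (rows cs i) (rows cs j) ≡ crossings cs i j
  hamming-rows [] i j = refl
  hamming-rows (c ∷ cs) i j = cong (_ +_) (hamming-rows cs i j)

module _ {n : ℕ} (G : WeightedGraph n) where

  IPFeasible⇒≤cutSum : ∀ {S} → IPFeasible G S → ∀ u v d → IsDist G u v d → d ≤ cutSum S u v
  IPFeasible⇒≤cutSum {S} feasible u v d isDist with <-cmpᶠ u v
  ... | tri< u<v _ _ = feasible u v u<v d isDist
  ... | tri≈ _ refl _ = ≤-trans (≤-reflexive (IsDist-diag G isDist)) z≤n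
  ... | tri> _ _ v<u = subst (d ≤_) (cutSum-sym S v u) (feasible v u v<u d (IsDist-sym G isDist))

  addressing⇒IPFeasible : ∀ {m f} → IsAddressing G m f → IPFeasible G (multiplicity (columns f))
  addressing⇒IPFeasible {f = f} addressing i j _ d isDist =
    subst (d ≤_) (trans (hamming-columns f i j) (sym (cutSum-multiplicity (columns f) i j)))
          (addressing i j d isDist)

  IPFeasible⇒addressing : ∀ {S} → IPFeasible G S → IsAddressing G _ (rows (cuts S))
  IPFeasible⇒addressing {S} feasible u v d isDist =
    subst (d ≤_) (sym (trans (hamming-rows (cuts S) u v) (crossings-cuts S u v)))
          (IPFeasible⇒≤cutSum feasible u v d isDist)

  addressing⇔IPFeasible : ∀ m →
    Σ (Fin n → Vec Bool m) (IsAddressing G m) ⇔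
    Σ (Subset n → ℕ) (λ S → IPFeasible G S × totalSum S ≡ m)
  addressing⇔IPFeasible m = mk⇔
    (λ (f , addressing) →
       multiplicity (columns f) , addressing⇒IPFeasible {f = f} addressing ,
       trans (totalSum-multiplicity (columns f)) (length-columns f))
    (λ (S , feasible , total≡m) →
       subst (λ k → Σ (Fin n → Vec Bool k) (IsAddressing G k)) (trans (length-cuts S) total≡m)
             (rows (cuts S) , IPFeasible⇒addressing feasible))

  module _ (connected : Connected G) where

    dist : Fin n → Fin n → ℕ
    dist u v = proj₁ (distance G connected u v)

    IsDist-dist : ∀ u v → IsDist G u v (dist u v)
    IsDist-dist u v = proj₂ (distance G connected u v)

    addressing⇔dist-dominated : ∀ m →
      Σ (Vec (Vec Bool m) n) (λ F → ∀ u v → dist u v ≤ hamming (lookup F u) (lookup F v)) ⇔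
      Σ (Fin n → Vec Bool m) (IsAddressing G m)
    addressing⇔dist-dominated m = mk⇔
      (λ (F , dominated) → lookup F , λ u v d isDist →
         subst (_≤ _) (IsDist-functional G (IsDist-dist u v) isDist) (dominated u v))
      (λ (f , addressing) → tabulate f , λ u v →
         subst₂ (λ a b → dist u v ≤ hamming a b) (sym (lookup∘tabulate f u)) (sym (lookup∘tabulate f v))
                (addressing u v _ (IsDist-dist u v)))

    addressing? : Decidable (λ m → Σ (Fin n → Vec Bool m) (IsAddressing G m))
    addressing? m = Dec.map (addressing⇔dist-dominated m) (any-Vec? anySubset? λ F →
      all? λ u → all? λ v → dist u v ≤? hamming (lookup F u) (lookup F v))

    diameter : ℕ
    diameter = maxFin (λ u → maxFin (dist u))

    IPFeasible-diameter : IPFeasible G (λ _ → diameter)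
    IPFeasible-diameter i j i<j d isDist = begin
      d                                              ≡⟨ IsDist-functional G isDist (IsDist-dist i j) ⟩
      dist i j                                       ≤⟨ ≤-maxFin (dist i) j ⟩
      maxFin (dist i)                                ≤⟨ ≤-maxFin (λ u → maxFin (dist u)) i ⟩
      diameter                                       ≡⟨ cong (λ b → if b then diameter else 0) ⁅i⁆-separates ⟨
      (if Separates ⁅ i ⁆ i j then diameter else 0)  ≤⟨ ∈⇒≤sum-map _ (∈-allSubsets ⁅ i ⁆) ⟩
      cutSum (λ _ → diameter) i j                    ∎
      where
      open ≤-Reasoning
      ⁅i⁆-separates : Separates ⁅ i ⁆ i j ≡ true
      ⁅i⁆-separates = Separates-⁅⁆ (<⇒≢ᶠ i<j)

    someAddressing : ∃ λ m → Σ (Fin n → Vec Bool m) (IsAddressing G m)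
    someAddressing = _ , Equivalence.from (addressing⇔IPFeasible _) (_ , IPFeasible-diameter , refl)

theorem4 : ∀ (n : ℕ) (G : WeightedGraph n) → WeightMinimal G → Connected G →
    Σ ℕ (λ m → IsAddressingNumber G m × IsIPOptimum G m)
theorem4 n G _ connected =
  let m , addressingNumber = least (addressing? G connected) (proj₂ (someAddressing G connected))
  in  m , addressingNumber , IsMin-resp-⇔ (addressing⇔IPFeasible G) addressingNumber
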